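{- Let $m\in\mathbb{N}$ and $k\in\mathbb{N}$ with $k\ge 2$, and put $r_{m,k}=1+\left\lfloor\frac{m-1}{p_k}\right\rfloor$. Then $\nu_{max}(m,k)\le r_{m,k}-\psi_{min}(r_{m,k},k-1)$.
   Context: Let $p_1=2,p_2=3,p_3=5,\dots$ be the primes in increasing order. For $a\in\mathbb{Z}$, $m\in\mathbb{N}$, define $\psi(a,m,1)=0$ and, for $k\ge 2$, $\psi(a,m,k)=|\{q\in\{1,\dots,m\}\mid \exists i\in\{2,\dots,k\}: a+q\equiv 0\pmod{p_i}\}|$ (the prime $2$ is not used). Define $\nu(a,m,1)=0$ and $\nu(a,m,k)=\psi(a,m,k)-\psi(a,m,k-1)$ for $k\ge2$. Further $\psi_{min}(m,k)=\min_{a\in\mathbb{Z}}\psi(a,m,k)$ and $\nu_{max}(m,k)=\max_{a\in\mathbb{Z}}\nu(a,m,k)$. $\lfloor x\rfloor$ is the greatest integer not exceeding $x$. -}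

module Defs where

open import Data.Nat using (ℕ; zero; suc; _+_; _∸_; _<_; _≤_; _≥_; _/_)
open import Data.Nat.Primality using (Prime)
open import Data.Integer as ℤ using (ℤ; +_)
open import Data.Integer.Divisibility using (_∣_)
open import Data.Nat.Divisibility using (_∣?_)
open import Data.List using (List; map; upTo; filter; length)
open import Data.List.Relation.Unary.Any using (Any; any?)
open import Data.Product using (Σ; ∃; _×_)
open import Relation.Nullary using (Dec)
open import Relation.Binary.PropositionalEquality using (_≡_)

-- p : ℕ → ℕ enumerates the primes in increasing order, 1-indexed:
-- p 1 = 2, p 2 = 3, p 3 = 5, ...  (the value p 0 is irrelevant).
-- This characterises p uniquely on indices ≥ 1.
record IsPrimeEnumeration (p : ℕ → ℕ) : Set where
  field
    prime    : ∀ i → 1 ≤ i → Prime (p i)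
    strictly : ∀ i j → 1 ≤ i → i < j → p i < p j
    onto     : ∀ q → Prime q → Σ ℕ λ i → 1 ≤ i × p i ≡ q

range : ℕ → ℕ → List ℕ
range lo n = map (λ j → lo + j) (upTo n)

Hit : (ℕ → ℕ) → ℤ → ℕ → ℕ → Set
Hit p a k q = Any (λ i → + (p i) ∣ (a ℤ.+ + q)) (range 2 (k ∸ 1))

hit? : ∀ p a k q → Dec (Hit p a k q)
hit? p a k q = any? (λ i → p i ∣? ℤ.∣ a ℤ.+ + q ∣) (range 2 (k ∸ 1))

-- ψ(a,m,k) = |{q ∈ {1,…,m} : ∃ i ∈ {2,…,k}, a + q ≡ 0 (mod p_i)}|
-- (for k = 1 the index set {2,…,1} is empty, so ψ(a,m,1) = 0)
ψ : (ℕ → ℕ) → ℤ → ℕ → ℕ → ℕ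
ψ p a m k = length (filter (hit? p a k) (range 1 m))

ν : (ℕ → ℕ) → ℤ → ℕ → ℕ → ℕ
ν p a m zero = 0
ν p a m (suc zero) = 0
ν p a m (suc (suc k)) = ψ p a m (suc (suc k)) ∸ ψ p a m (suc k)

IsMinℤ : (ℤ → ℕ) → ℕ → Set
IsMinℤ f x = (∃ λ a → f a ≡ x) × (∀ a → x ≤ f a)

IsMaxℤ : (ℤ → ℕ) → ℕ → Set
IsMaxℤ f x = (∃ λ a → f a ≡ x) × (∀ a → f a ≤ x)

-- r_{m,k} = 1 + ⌊(m-1)/p_k⌋.  For m = 0 this is 1 + ⌊-1/p_k⌋ = 0.
-- The divisor is written suc (p k ∸ 1), which equals p k since p k is prime (≥ 2).
r : (ℕ → ℕ) → ℕ → ℕ → ℕ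
r p zero    k = 0
r p (suc m) k = 1 + (m / suc (p k ∸ 1))

-- The integers a + q (1 ≤ q ≤ m) counted by ν(a,m,k) are multiples P·y of P = p_k none of whose
-- prime factors lies among p_2, …, p_{k-1}; as P is coprime to those primes, the same holds for y.
-- The multiples of P among m consecutive integers are P·y for at most r_{m,k} consecutive values
-- of y, and among any r_{m,k} consecutive integers at least ψ_min(r_{m,k}, k-1) are hit by one of
-- p_2, …, p_{k-1}.
module Submission where

open import Defs
open import Data.Nat using (ℕ; _≤_; _∸_; _≥_)
open import Data.Nat as ℕ using (zero; suc; _<_; z≤n; s≤s; _/_)
import Data.Nat.Properties as ℕP
open import Algebra.Properties.CommutativeSemigroup ℕP.+-commutativeSemigroup
  using () renaming (interchange to +-interchange)
import Data.Nat.DivMod as ℕDM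
import Data.Nat.Divisibility as ℕD
open import Data.Nat.Primality using (Prime; euclidsLemma; prime⇒irreducible; ¬prime[0]; ¬prime[1])
open import Data.Integer as ℤ using (ℤ; +_; _/ℕ_; _%ℕ_)
import Data.Integer.Properties as ℤP
open import Data.Integer.Divisibility using (_∣_)
import Data.Integer.Divisibility.Signed as ℤS
open import Data.Integer.DivMod using (a≡a%ℕn+[a/ℕn]*n; n%ℕd<d)
open import Data.Integer.Tactic.RingSolver using (solve-∀)
open import Data.List using (_∷_; map; upTo; filter; length; applyUpTo)
open import Data.List.Properties using (map-upTo)
open import Data.List.Relation.Unary.Any using (Any; any?)
import Data.List.Relation.Unary.Any.Properties as AnyP
open import Data.Product using (∃; ∃₂; _×_; _,_)
open import Data.Sum using (inj₁; inj₂)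
open import Data.Bool using (true; false; if_then_else_)
open import Function using (_⇔_; mk⇔; Equivalence)
open import Level using (0ℓ)
open import Relation.Nullary using (Dec; yes; no; ¬_; does; contradiction)
open import Relation.Nullary.Decidable using (¬?; _×-dec_)
open import Relation.Unary using (Pred; Decidable; _⊆_; _∪_; ∁)
open import Relation.Unary.Properties using (∁?)
open import Relation.Binary.PropositionalEquality

indicator : {A : Set} → Dec A → ℕ
indicator A? = if does A? then 1 else 0

indicator-⊥ : {A : Set} → ¬ A → (A? : Dec A) → indicator A? ≡ 0
indicator-⊥ ¬a (yes a) = contradiction a ¬a
indicator-⊥ ¬a (no _)  = refl

indicator-cong : {A B : Set} → A ⇔ B → (A? : Dec A) (B? : Dec B) → indicator A? ≡ indicator B?
indicator-cong A⇔B (yes a) (yes b) = refl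
indicator-cong A⇔B (yes a) (no ¬b) = contradiction (Equivalence.to A⇔B a) ¬b
indicator-cong A⇔B (no ¬a) (yes b) = contradiction (Equivalence.from A⇔B b) ¬a
indicator-cong A⇔B (no ¬a) (no ¬b) = refl

count : {P : Pred ℤ 0ℓ} → Decidable P → ℤ → ℕ → ℕ
count P? b zero    = 0
count P? b (suc n) = indicator (P? b) ℕ.+ count P? (ℤ.suc b) n

module _ {P : Pred ℤ 0ℓ} (P? : Decidable P) where

  count-∁ : ∀ b n → count P? b n ℕ.+ count (∁? P?) b n ≡ n
  count-∁ b zero    = refl
  count-∁ b (suc n) with P? b
  ... | yes _ = cong suc (count-∁ (ℤ.suc b) n)
  ... | no _  = trans (ℕP.+-suc _ _) (cong suc (count-∁ (ℤ.suc b) n))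

  count-∁≡∸ : ∀ b n → count (∁? P?) b n ≡ n ∸ count P? b n
  count-∁≡∸ b n = trans (sym (ℕP.m+n∸m≡n (count P? b n) _)) (cong (_∸ count P? b n) (count-∁ b n))

  count-⊆-∪ : {Q R : Pred ℤ 0ℓ} (Q? : Decidable Q) (R? : Decidable R) → P ⊆ Q ∪ R →
              ∀ b n → count P? b n ≤ count Q? b n ℕ.+ count R? b n
  count-⊆-∪ Q? R? P⊆Q∪R b zero    = z≤n
  count-⊆-∪ Q? R? P⊆Q∪R b (suc n) = ℕP.≤-trans
    (ℕP.+-mono-≤ (indicator-⊆-∪ (P? b) (Q? b) (R? b)) (count-⊆-∪ Q? R? P⊆Q∪R (ℤ.suc b) n))
    (ℕP.≤-reflexive (+-interchange (indicator (Q? b)) (indicator (R? b)) _ _))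
    where
    indicator-⊆-∪ : ∀ {x} (Px? : Dec (P x)) Qx? Rx? → indicator Px? ≤ indicator Qx? ℕ.+ indicator Rx?
    indicator-⊆-∪ (no _)  _ _ = z≤n
    indicator-⊆-∪ (yes px) Qx? Rx? with P⊆Q∪R px | Qx? | Rx?
    ... | _       | yes _ | _      = s≤s z≤n
    ... | _       | no _  | yes _  = ℕP.≤-refl
    ... | inj₁ qx | no ¬q | no _   = contradiction qx ¬q
    ... | inj₂ rx | no _  | no ¬r  = contradiction rx ¬r

+-suc-comm : ∀ a x → a ℤ.+ (+ 1 ℤ.+ x) ≡ + 1 ℤ.+ (a ℤ.+ x)
+-suc-comm = solve-∀

length-filter-shifted : {P : Pred ℤ 0ℓ} (P? : Decidable P) (a : ℤ) (g : ℕ → ℕ) (c n : ℕ) →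
  (∀ j → g j ≡ c ℕ.+ j) →
  length (filter (λ q → P? (a ℤ.+ + q)) (applyUpTo g n)) ≡ count P? (a ℤ.+ + c) n
length-filter-shifted P? a g c zero    g≗c+ = refl
length-filter-shifted {P} P? a g c (suc n) g≗c+ = begin
    length (filter P?+a (g 0 ∷ applyUpTo (λ j → g (suc j)) n))
      ≡⟨ length-filter-∷ (g 0) _ ⟩
    indicator (P? (a ℤ.+ + g 0)) ℕ.+ length (filter P?+a (applyUpTo (λ j → g (suc j)) n))
      ≡⟨ cong₂ (λ z w → indicator (P? (a ℤ.+ + z)) ℕ.+ w) (trans (g≗c+ 0) (ℕP.+-identityʳ c))
           (length-filter-shifted P? a (λ j → g (suc j)) (suc c) n
              (λ j → trans (g≗c+ (suc j)) (ℕP.+-suc c j))) ⟩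
    indicator (P? (a ℤ.+ + c)) ℕ.+ count P? (a ℤ.+ + suc c) n
      ≡⟨ cong (λ b → indicator (P? (a ℤ.+ + c)) ℕ.+ count P? b n) (+-suc-comm a (+ c)) ⟩
    count P? (a ℤ.+ + c) (suc n) ∎
  where
  open ≡-Reasoning
  P?+a : Decidable (λ q → P (a ℤ.+ + q))
  P?+a q = P? (a ℤ.+ + q)
  length-filter-∷ : ∀ x xs → length (filter P?+a (x ∷ xs)) ≡ indicator (P?+a x) ℕ.+ length (filter P?+a xs)
  length-filter-∷ x xs with does (P?+a x)
  ... | true  = refl
  ... | false = refl

Any-range⁻ : {P : Pred ℕ 0ℓ} → ∀ lo n → Any P (range lo n) → ∃ λ j → j < n × P (lo ℕ.+ j)
Any-range⁻ lo n p = AnyP.applyUpTo⁻ (λ j → j) (AnyP.map⁻ p)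

Any-range⁺ : {P : Pred ℕ 0ℓ} → ∀ lo {n} j → j < n → P (lo ℕ.+ j) → Any P (range lo n)
Any-range⁺ lo j j<n p = AnyP.map⁺ (AnyP.applyUpTo⁺ (λ j → j) p j<n)

-- Hit p a k q of Defs is HitAt p k (a + q) by definition.
HitAt : (ℕ → ℕ) → ℕ → Pred ℤ 0ℓ
HitAt p k x = Any (λ i → + p i ∣ x) (range 2 (k ∸ 1))

hitAt? : ∀ p k → Decidable (HitAt p k)
hitAt? p k x = any? (λ i → p i ℕD.∣? ℤ.∣ x ∣) (range 2 (k ∸ 1))

FirstHit : (ℕ → ℕ) → ℕ → Pred ℤ 0ℓ
FirstHit p k x = (+ p k ∣ x) × ¬ HitAt p (k ∸ 1) x

firstHit? : ∀ p k → Decidable (FirstHit p k)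
firstHit? p k x = (p k ℕD.∣? ℤ.∣ x ∣) ×-dec ¬? (hitAt? p (k ∸ 1) x)

ψ≡count-hitAt : ∀ p a m k → ψ p a m k ≡ count (hitAt? p k) (ℤ.suc a) m
ψ≡count-hitAt p a m k = begin
  length (filter (hit? p a k) (map (1 ℕ.+_) (upTo m)))
    ≡⟨ cong (λ xs → length (filter (hit? p a k) xs)) (map-upTo (1 ℕ.+_) m) ⟩
  length (filter (hit? p a k) (applyUpTo (1 ℕ.+_) m))
    ≡⟨ length-filter-shifted (hitAt? p k) a (1 ℕ.+_) 1 m (λ _ → refl) ⟩
  count (hitAt? p k) (a ℤ.+ + 1) m
    ≡⟨ cong (λ b → count (hitAt? p k) b m) (ℤP.+-comm a (+ 1)) ⟩
  count (hitAt? p k) (ℤ.suc a) m ∎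
  where open ≡-Reasoning

hitAt-suc : ∀ p k → HitAt p (suc k) ⊆ HitAt p k ∪ FirstHit p (suc k)
hitAt-suc p zero    ()
hitAt-suc p (suc k) {x} h with hitAt? p (suc k) x
... | yes h′ = inj₁ h′
... | no ¬h′ with Any-range⁻ 2 (suc k) h
... | j , j<1+k , pⱼ∣x with j ℕP.<? k
... | yes j<k = contradiction (Any-range⁺ 2 j j<k pⱼ∣x) ¬h′
... | no j≮k  = inj₂ (subst (λ i → + p (2 ℕ.+ i) ∣ x) j≡k pⱼ∣x , ¬h′)
  where
  j≡k : j ≡ k
  j≡k = ℕP.≤-antisym (ℕ.s≤s⁻¹ j<1+k) (ℕP.≮⇒≥ j≮k)

ν≤count-firstHit : ∀ p a m k → ν p a m k ≤ count (firstHit? p k) (ℤ.suc a) m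
ν≤count-firstHit p a m zero          = z≤n
ν≤count-firstHit p a m (suc zero)    = z≤n
ν≤count-firstHit p a m (suc (suc k))
  rewrite ψ≡count-hitAt p a m (suc (suc k)) | ψ≡count-hitAt p a m (suc k) =
  ℕP.m≤n+o⇒m∸n≤o _ _
    (count-⊆-∪ (hitAt? p (suc (suc k))) (hitAt? p (suc k)) (firstHit? p (suc (suc k)))
       (λ {x} → hitAt-suc p (suc k) {x}) (ℤ.suc a) m)

module _ {p : ℕ → ℕ} (p-enum : IsPrimeEnumeration p) where
  open IsPrimeEnumeration p-enum

  p[1+k]≡suc[p[1+k]∸1] : ∀ k → p (suc k) ≡ suc (p (suc k) ∸ 1)
  p[1+k]≡suc[p[1+k]∸1] k with p (suc k) | prime (suc k) (s≤s z≤n)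
  ... | zero  | p0 = contradiction p0 ¬prime[0]
  ... | suc _ | _  = refl

  p∣*⇒p∣ : ∀ {i j} → 1 ≤ i → i < j → ∀ n → p i ℕD.∣ p j ℕ.* n → p i ℕD.∣ n
  p∣*⇒p∣ {i} {j} 1≤i i<j n pᵢ∣pⱼn with euclidsLemma (p j) n (prime i 1≤i) pᵢ∣pⱼn
  ... | inj₂ pᵢ∣n  = pᵢ∣n
  ... | inj₁ pᵢ∣pⱼ with prime⇒irreducible (prime j (ℕP.≤-trans 1≤i (ℕP.<⇒≤ i<j))) pᵢ∣pⱼ
  ... | inj₁ pᵢ≡1  = contradiction (subst Prime pᵢ≡1 (prime i 1≤i)) ¬prime[1]
  ... | inj₂ pᵢ≡pⱼ = contradiction pᵢ≡pⱼ (ℕP.<⇒≢ (strictly i j 1≤i i<j))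

  hitAt-*⇔ : ∀ k y → HitAt p (suc k) (+ p (2 ℕ.+ k) ℤ.* y) ⇔ HitAt p (suc k) y
  hitAt-*⇔ k y = mk⇔ cancel multiply
    where
    ∣Py∣≡ : ℤ.∣ + p (2 ℕ.+ k) ℤ.* y ∣ ≡ p (2 ℕ.+ k) ℕ.* ℤ.∣ y ∣
    ∣Py∣≡ = ℤP.abs-* (+ p (2 ℕ.+ k)) y
    cancel : HitAt p (suc k) (+ p (2 ℕ.+ k) ℤ.* y) → HitAt p (suc k) y
    cancel h with Any-range⁻ 2 k h
    ... | j , j<k , pⱼ∣Py = Any-range⁺ 2 j j<k
      (p∣*⇒p∣ (s≤s z≤n) (s≤s (s≤s j<k)) ℤ.∣ y ∣ (subst (p (2 ℕ.+ j) ℕD.∣_) ∣Py∣≡ pⱼ∣Py))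
    multiply : HitAt p (suc k) y → HitAt p (suc k) (+ p (2 ℕ.+ k) ℤ.* y)
    multiply h with Any-range⁻ 2 k h
    ... | j , j<k , pⱼ∣y = Any-range⁺ 2 j j<k
      (subst (p (2 ℕ.+ j) ℕD.∣_) (sym ∣Py∣≡) (ℕD.∣n⇒∣m*n (p (2 ℕ.+ k)) pⱼ∣y))

  firstHit-*⇔ : ∀ k y → FirstHit p (2 ℕ.+ k) (+ p (2 ℕ.+ k) ℤ.* y) ⇔ ∁ (HitAt p (suc k)) y
  firstHit-*⇔ k y = mk⇔
    (λ (_ , ¬hit) hit → ¬hit (Equivalence.from (hitAt-*⇔ k y) hit))
    (λ ¬hit → subst (p (2 ℕ.+ k) ℕD.∣_) (sym (ℤP.abs-* (+ p (2 ℕ.+ k)) y)) (ℕD.m∣m*n ℤ.∣ y ∣)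
            , λ hit → ¬hit (Equivalence.to (hitAt-*⇔ k y) hit))

+-[-]-assoc : ∀ a b c → a ℤ.+ (b ℤ.- c) ≡ (a ℤ.+ b) ℤ.- c
+-[-]-assoc = solve-∀

+-*-cancel : ∀ a q d → (a ℤ.+ q ℤ.* d) ℤ.- a ≡ d ℤ.* q
+-*-cancel = solve-∀

suc-+-suc : ∀ b t → (+ 1 ℤ.+ b) ℤ.+ t ≡ b ℤ.+ (+ 1 ℤ.+ t)
suc-+-suc = solve-∀

suc-*-+ : ∀ n y → (+ 1 ℤ.+ (+ 1 ℤ.+ n) ℤ.* y) ℤ.+ n ≡ (+ 1 ℤ.+ n) ℤ.* (+ 1 ℤ.+ y)
suc-*-+ = solve-∀

⌈_/suc_⌉ : ℕ → ℕ → ℕ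
⌈ zero  /suc n ⌉ = 0
⌈ suc m /suc n ⌉ = 1 ℕ.+ m / suc n

m≤⌈m/1+n⌉*[1+n] : ∀ m n → m ≤ ⌈ m /suc n ⌉ ℕ.* suc n
m≤⌈m/1+n⌉*[1+n] zero    n = z≤n
m≤⌈m/1+n⌉*[1+n] (suc m) n = s≤s (begin
  m                              ≡⟨ ℕDM.m≡m%n+[m/n]*n m (suc n) ⟩
  m ℕ.% suc n ℕ.+ m / suc n ℕ.* suc n ≤⟨ ℕP.+-monoˡ-≤ _ (ℕ.s≤s⁻¹ (ℕDM.m%n<n m (suc n))) ⟩
  n ℕ.+ m / suc n ℕ.* suc n      ∎)
  where open ℕP.≤-Reasoning

r≡⌈m/p⌉ : ∀ p m k → r p m k ≡ ⌈ m /suc (p k ∸ 1) ⌉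
r≡⌈m/p⌉ p zero    k = refl
r≡⌈m/p⌉ p (suc m) k = refl

∃-cofactor-offset : ∀ n b → ∃₂ λ y t → t ≤ n × b ℤ.+ + t ≡ + suc n ℤ.* y
∃-cofactor-offset n b = b+n /ℕ suc n , n ∸ ρ , ℕP.m∸n≤m n ρ , (begin
    b ℤ.+ + (n ∸ ρ)              ≡⟨ cong (λ z → b ℤ.+ z) (trans (sym (ℤP.⊖-≥ ρ≤n)) (sym (ℤP.m-n≡m⊖n n ρ))) ⟩
    b ℤ.+ (+ n ℤ.- + ρ)          ≡⟨ +-[-]-assoc b (+ n) (+ ρ) ⟩
    b+n ℤ.- + ρ                  ≡⟨ cong (ℤ._- + ρ) (a≡a%ℕn+[a/ℕn]*n b+n (suc n)) ⟩
    (+ ρ ℤ.+ (b+n /ℕ suc n) ℤ.* + suc n) ℤ.- + ρ ≡⟨ +-*-cancel (+ ρ) (b+n /ℕ suc n) (+ suc n) ⟩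
    + suc n ℤ.* (b+n /ℕ suc n)  ∎)
  where
  open ≡-Reasoning
  b+n = b ℤ.+ + n
  ρ = b+n %ℕ suc n
  ρ≤n : ρ ≤ n
  ρ≤n = ℕ.s≤s⁻¹ (n%ℕd<d b+n (suc n))

-- With b + t = N·y and t < N, the multiples of N from b on are N·y, N·(y+1), … at offsets t, t + N, ….
module Cofactors (n : ℕ) {F G : Pred ℤ 0ℓ} (F? : Decidable F) (G? : Decidable G)
  (F⊆N∣ : F ⊆ (+ suc n ∣_)) (F[N*y]⇔G : ∀ y → F (+ suc n ℤ.* y) ⇔ G y) where

  count-≤-count-cofactors : ∀ m t b y q → t ≤ n → b ℤ.+ + t ≡ + suc n ℤ.* y →
                            m ≤ t ℕ.+ q ℕ.* suc n → count F? b m ≤ count G? y q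
  count-≤-count-cofactors zero    t       b y q       _   _ _ = z≤n
  count-≤-count-cofactors (suc m) zero    b y zero    _   _ ()
  count-≤-count-cofactors (suc m) zero    b y (suc q) _   b+0≡Ny (s≤s m≤n+qN) =
    ℕP.+-mono-≤ (ℕP.≤-reflexive (indicator-cong Fb⇔Gy (F? b) (G? y)))
      (count-≤-count-cofactors m n (ℤ.suc b) (ℤ.suc y) q ℕP.≤-refl
         (trans (cong (λ x → ℤ.suc x ℤ.+ + n) b≡Ny) (suc-*-+ (+ n) y)) m≤n+qN)
    where
    b≡Ny : b ≡ + suc n ℤ.* y
    b≡Ny = trans (sym (ℤP.+-identityʳ b)) b+0≡Ny
    Fb⇔Gy : F b ⇔ G y
    Fb⇔Gy = subst (λ x → F x ⇔ G y) (sym b≡Ny) (F[N*y]⇔G y)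
  count-≤-count-cofactors (suc m) (suc t) b y q 1+t≤n b+1+t≡Ny (s≤s m≤t+qN) =
    subst (_≤ count G? y q) (cong (ℕ._+ count F? (ℤ.suc b) m) (sym (indicator-⊥ ¬Fb (F? b))))
      (count-≤-count-cofactors m t (ℤ.suc b) y q (ℕP.≤-trans (ℕP.n≤1+n t) 1+t≤n)
         (trans (suc-+-suc b (+ t)) b+1+t≡Ny) m≤t+qN)
    where
    -- N would divide both b and b + (t + 1) = N·y, hence t + 1, which lies strictly between 0 and N.
    ¬Fb : ¬ F b
    ¬Fb Fb = ℕP.<⇒≱ 1+t≤n (ℕ.s≤s⁻¹ (ℕD.∣⇒≤ (ℤS.∣⇒∣ᵤ N∣1+t)))
      where
      N∣1+t : + suc n ℤS.∣ + suc t
      N∣1+t = ℤS.∣m+n∣m⇒∣n {m = b} (subst (+ suc n ℤS.∣_) (sym b+1+t≡Ny) (ℤS.divides y (ℤP.*-comm (+ suc n) y)))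
                           (ℤS.∣ᵤ⇒∣ (F⊆N∣ Fb))

  count-≤-count-cofactors-⌈/⌉ : ∀ b m → ∃ λ y → count F? b m ≤ count G? y ⌈ m /suc n ⌉
  count-≤-count-cofactors-⌈/⌉ b m with ∃-cofactor-offset n b
  ... | y , t , t≤n , b+t≡Ny = y , count-≤-count-cofactors m t b y ⌈ m /suc n ⌉ t≤n b+t≡Ny
                                 (ℕP.≤-trans (m≤⌈m/1+n⌉*[1+n] m n) (ℕP.m≤n+m _ t))

count-firstHit≤count-∁-hitAt : ∀ {p} → IsPrimeEnumeration p → ∀ k b m →
  ∃ λ y → count (firstHit? p (2 ℕ.+ k)) b m ≤ count (∁? (hitAt? p (suc k))) y (r p m (2 ℕ.+ k))
count-firstHit≤count-∁-hitAt {p} p-enum k b m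
  rewrite r≡⌈m/p⌉ p m (2 ℕ.+ k) =
  Cofactors.count-≤-count-cofactors-⌈/⌉ (p (2 ℕ.+ k) ∸ 1) (firstHit? p (2 ℕ.+ k)) (∁? (hitAt? p (suc k)))
    (λ {x} (pₖ∣x , _) → subst (λ N → + N ∣ x) pₖ≡N pₖ∣x)
    (λ y → subst (λ N → FirstHit p (2 ℕ.+ k) (+ N ℤ.* y) ⇔ ∁ (HitAt p (suc k)) y) pₖ≡N
                 (firstHit-*⇔ p-enum k y))
    b m
  where
  pₖ≡N : p (2 ℕ.+ k) ≡ suc (p (2 ℕ.+ k) ∸ 1)
  pₖ≡N = p[1+k]≡suc[p[1+k]∸1] p-enum (suc k)

lemma2p6 : (p : ℕ → ℕ) → IsPrimeEnumeration p →
    (m k : ℕ) → k ≥ 2 →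
    (ψmin νmax : ℕ) →
    IsMinℤ (λ a → ψ p a (r p m k) (k ∸ 1)) ψmin →
    IsMaxℤ (λ a → ν p a m k) νmax →
    νmax ≤ r p m k ∸ ψmin
lemma2p6 p p-enum m (suc zero) (s≤s ()) _ _ _ _
lemma2p6 p p-enum m (suc (suc k)) _ ψmin _ (_ , ψmin≤ψ) ((a , refl) , _)
  with count-firstHit≤count-∁-hitAt p-enum k (ℤ.suc a) m
... | y , firstHits≤ = begin
  ν p a m K                                          ≤⟨ ν≤count-firstHit p a m K ⟩
  count (firstHit? p K) (ℤ.suc a) m                  ≤⟨ firstHits≤ ⟩
  count (∁? (hitAt? p (suc k))) y R                  ≡⟨ count-∁≡∸ (hitAt? p (suc k)) y R ⟩
  R ∸ count (hitAt? p (suc k)) y R                   ≡⟨ cong (λ b → R ∸ count (hitAt? p (suc k)) b R) (ℤP.suc-pred y) ⟨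
  R ∸ count (hitAt? p (suc k)) (ℤ.suc (ℤ.pred y)) R  ≡⟨ cong (R ∸_) (ψ≡count-hitAt p (ℤ.pred y) R (suc k)) ⟨
  R ∸ ψ p (ℤ.pred y) R (suc k)                       ≤⟨ ℕP.∸-monoʳ-≤ R (ψmin≤ψ (ℤ.pred y)) ⟩
  R ∸ ψmin                                           ∎
  where
  open ℕP.≤-Reasoning
  K = suc (suc k)
  R = r p m K
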